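{- For $m,p,q\in\mathbb N$, the full transformation semigroup $\mathcal T_m$ contains a $p\times q$ uniform right null subsemigroup if and only if there exist compositions $\sigma$ and $\tau$ such that $\sigma$ is a composition of $m$, $\tau\preceq\sigma$, $\prod\tau\geq p$ and $\eta(\sigma,\tau)\geq q$.
   Context: $\mathcal T_m$ is the semigroup of all self-maps of $\{1,\dots,m\}$ under composition. A composition of $m$ is a tuple of positive integers summing to $m$. For tuples of positive integers $\sigma=(s_1,\dots,s_r)$, $\tau=(t_1,\dots,t_r)$ of the same length, write $\tau\preceq\sigma$ if $t_i\leq s_i$ for all $i$, and then $\eta(\sigma,\tau)=\prod_{i=1}^r t_i^{s_i-t_i}$; also $\prod\tau=t_1\cdots t_r$. A $p\times q$ uniform right null semigroup is a semigroup $S=\bigcup_{b\in B}S_b$ where $B$ is a right zero semigroup ($xy=y$) with $|B|=p$, the $S_b$ are pairwise disjoint subsemigroups, each a null semigroup ($S_b^2=\{z_b\}$) of size $q$, and $S_bS_c=\{z_c\}$ for all $b,c\in B$. -}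

module Defs where

open import Data.Nat using (ℕ; _≤_; _^_; _∸_)
open import Data.Fin using (Fin)
open import Data.List using (List; zipWith)
open import Data.Nat.ListAction using (sum; product)
open import Data.List.Relation.Unary.All using (All)
open import Data.List.Relation.Binary.Pointwise using (Pointwise)
open import Data.Product using (_×_)
open import Relation.Binary.PropositionalEquality using (_≡_; _≗_)

Tm : ℕ → Set
Tm m = Fin m → Fin m

-- Product in 𝒯_m. Maps act on the right (standard in semigroup theory):
-- xy means "first x, then y", i.e. (x · y)(u) = y (x u).
_·_ : ∀ {m} → Tm m → Tm m → Tm m
(x · y) u = y (x u)

Positive : List ℕ → Set
Positive = All (1 ≤_)

IsCompositionOf : ℕ → List ℕ → Set
IsCompositionOf m σ = Positive σ × sum σ ≡ m

_⪯_ : List ℕ → List ℕ → Set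
τ ⪯ σ = Pointwise _≤_ τ σ

-- η(σ,τ) = ∏ tᵢ ^ (sᵢ - tᵢ)   (used only when τ ⪯ σ, so lengths agree)
η : List ℕ → List ℕ → ℕ
η σ τ = product (zipWith (λ s t → t ^ (s ∸ t)) σ τ)

∏ : List ℕ → ℕ
∏ τ = product τ

-- A p × q uniform right null subsemigroup of 𝒯_m, written out:
-- S = ⋃_{b ∈ B} S_b with |B| = p, S_b = { elt b i | i : Fin q } of size q
-- (injectivity gives |S_b| = q and pairwise disjointness), z_b = elt b (zeroIdx b),
-- and S_b S_c = {z_c} for all b, c (including b = c, i.e. S_b² = {z_b}).
-- In particular S is closed under the product, hence a subsemigroup of 𝒯_m,
-- and B (indexed by Fin p) carries the right-zero structure bc = c.
record URNSubsemigroup (m p q : ℕ) : Set where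
  field
    elt        : Fin p → Fin q → Tm m
    zeroIdx    : Fin p → Fin q
    elt-inj    : ∀ b i c j → elt b i ≗ elt c j → (b ≡ c × i ≡ j)
    elt-mult   : ∀ b i c j → (elt b i · elt c j) ≗ elt c (zeroIdx c)

-- A block of s points, t ≥ 1 of them marked, carries the maps sending every marked point to one
-- marked point β and each of the s − t unmarked points to some marked point. A product of two such
-- maps is the constant map onto the β of the second factor, so these t · t^(s−t) maps form a
-- t × t^(s−t) uniform right null semigroup whose zeros are the constant maps; letting blocks act
-- side by side on disjoint sets of points multiplies both dimensions.
--
-- Conversely, fix a zero ρ = z_b₀. Every product in S is a zero, so ρ is idempotent, z_b ∘ ρ = z_b,
-- and every element of S maps into the inert points: those v with x v = z_c v for all x ∈ S_c.
-- The fibres of ρ over its fixed points a partition the points (sizes s_a), and their inert parts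
-- have sizes t_a ≥ 1 since they contain a. Each z_b is determined by its values at the fixed points,
-- and sends a into the inert part of fibre a, so p ≤ ∏ t_a. The elements of S_b₀ all agree on inert
-- points and send each non-inert point of fibre a into its inert part, so q ≤ ∏ t_a^(s_a − t_a).

module Submission where

open import Defs
open import Data.Nat using (ℕ; zero; suc; _≤_; _≥_; _+_; _*_; _^_; _∸_)
open import Data.Nat.ListAction using (sum; product)
open import Data.Nat.ListAction.Properties using (product-++)
open import Data.Nat.Properties using (+-suc; ≤-trans; m+n∸m≡n; m+[n∸m]≡n)
open import Data.Fin using (Fin; zero; suc; _≟_; splitAt; join; _↑ˡ_; _↑ʳ_; quotient; remainder; remQuot; combine; inject≤; finToFun; funToFin)
open import Data.Fin.Properties using (all?; injective⇒≤; splitAt-join; splitAt-↑ˡ; splitAt-↑ʳ; ↑ˡ-injective; ↑ʳ-injective; remQuot-combine; combine-remQuot; inject≤-injective; finToFun-funToFin; funToFin-finToFin)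
open import Data.Fin.Permutation.Components using (transpose; transpose-inverse)
open import Data.List using (List; []; _∷_; [_]; _++_; map; filter; length; lookup; allFin; concatMap; cartesianProductWith)
open import Data.List.Properties using (map-++; length-++; length-map; map-cong; map-cong-local; filter-accept; filter-reject; ∷-injective; length-filter; length-tabulate)
open import Data.List.Membership.Propositional using (_∈_; lose)
open import Data.List.Membership.Propositional.Properties using (∈-cartesianProductWith⁺; ∈-filter⁺; ∈-allFin; ∈-length; ∈-concatMap⁺)
open import Data.List.Relation.Unary.All as All using (All; []; _∷_)
open import Data.List.Relation.Unary.All.Properties as All using (all-filter)
open import Data.List.Relation.Unary.Any using (here; there; index)
open import Data.List.Relation.Unary.Any.Properties using (lookup-index)
open import Data.List.Relation.Unary.AllPairs using (_∷_)
open import Data.List.Relation.Unary.Unique.Propositional using (Unique)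
import Data.List.Relation.Unary.Unique.Propositional.Properties as Unique
open import Data.List.Relation.Binary.Pointwise using (Pointwise; []; _∷_)
open import Data.Product using (_×_; _,_; proj₁; proj₂; uncurry; ∃₂)
open import Data.Sum using (inj₁; inj₂; [_,_]′)
import Data.Sum as Sum
open import Function using (_∘_; const)
open import Function.Bundles using (_⇔_; mk⇔)
open import Function.Definitions using (Injective)
open import Relation.Binary.Definitions using (DecidableEquality)
open import Relation.Binary.PropositionalEquality using (_≡_; _≗_; refl; sym; trans; cong; cong₂; cong-app; subst; module ≡-Reasoning)
open import Relation.Nullary using (¬_; Dec; yes; no)
open import Relation.Nullary.Decidable using (dec-true)
open import Relation.Unary using (Decidable)
open import Relation.Unary.Properties using (∁?)

private variable
  A B : Set
  m n s p q P Q P₁ Q₁ P₂ Q₂ : ℕ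

module _ {P : A → Set} (P? : Decidable P) where

  length-filter-∁ : ∀ xs → length (filter P? xs) + length (filter (∁? P?) xs) ≡ length xs
  length-filter-∁ [] = refl
  length-filter-∁ (x ∷ xs) with P? x
  ... | yes _ = cong suc (length-filter-∁ xs)
  ... | no _  = trans (+-suc _ _) (cong suc (length-filter-∁ xs))

pointwise-map : ∀ {R : B → B → Set} {f g : A → B} {xs} →
                All (λ x → R (f x) (g x)) xs → Pointwise R (map f xs) (map g xs)
pointwise-map []       = []
pointwise-map (r ∷ rs) = r ∷ pointwise-map rs

map-≡⇒All : ∀ {f g : A → B} xs → map f xs ≡ map g xs → All (λ x → f x ≡ g x) xs
map-≡⇒All []       _  = []
map-≡⇒All (x ∷ xs) eq = let fx≡gx , eqs = ∷-injective eq in fx≡gx ∷ map-≡⇒All xs eqs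

product-map-const : ∀ {f : A → ℕ} {c} {xs} → All (λ x → f x ≡ c) xs → product (map f xs) ≡ c ^ length xs
product-map-const []           = refl
product-map-const (fx≡c ∷ eqs) = cong₂ _*_ fx≡c (product-map-const eqs)

product-map-concatMap : ∀ (f : B → ℕ) (g : A → List B) xs →
  product (map f (concatMap g xs)) ≡ product (map (λ x → product (map f (g x))) xs)
product-map-concatMap f g []       = refl
product-map-concatMap f g (x ∷ xs) = begin
  product (map f (g x ++ concatMap g xs))
    ≡⟨ cong product (map-++ f (g x) (concatMap g xs)) ⟩
  product (map f (g x) ++ map f (concatMap g xs))
    ≡⟨ product-++ (map f (g x)) _ ⟩
  product (map f (g x)) * product (map f (concatMap g xs))
    ≡⟨ cong (product (map f (g x)) *_) (product-map-concatMap f g xs) ⟩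
  product (map f (g x)) * product (map (λ y → product (map f (g y))) xs) ∎
  where open ≡-Reasoning

choices : (A → List B) → List A → List (List B)
choices R []       = [ [] ]
choices R (x ∷ xs) = cartesianProductWith _∷_ (R x) (choices R xs)

length-cartesianProductWith : ∀ {C : Set} (f : A → B → C) xs ys →
  length (cartesianProductWith f xs ys) ≡ length xs * length ys
length-cartesianProductWith f []       ys = refl
length-cartesianProductWith f (x ∷ xs) ys = begin
  length (map (f x) ys ++ cartesianProductWith f xs ys)
    ≡⟨ length-++ (map (f x) ys) ⟩
  length (map (f x) ys) + length (cartesianProductWith f xs ys)
    ≡⟨ cong₂ _+_ (length-map (f x) ys) (length-cartesianProductWith f xs ys) ⟩
  length ys + length xs * length ys ∎
  where open ≡-Reasoning

length-choices : ∀ (R : A → List B) xs → length (choices R xs) ≡ product (map (length ∘ R) xs)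
length-choices R []       = refl
length-choices R (x ∷ xs) =
  trans (length-cartesianProductWith _∷_ (R x) (choices R xs)) (cong (length (R x) *_) (length-choices R xs))

map-∈-choices : ∀ {R : A → List B} {f : A → B} {xs} → All (λ x → f x ∈ R x) xs → map f xs ∈ choices R xs
map-∈-choices []           = here refl
map-∈-choices (fx∈ ∷ fxs∈) = ∈-cartesianProductWith⁺ _∷_ fx∈ (map-∈-choices fxs∈)

injective⇒≤length : ∀ {n} (xs : List A) {f : Fin n → A} → (∀ i → f i ∈ xs) → Injective _≡_ _≡_ f → n ≤ length xs
injective⇒≤length xs {f} f∈xs f-inj = injective⇒≤ {f = index ∘ f∈xs} λ {i} {j} eq →
  f-inj (trans (lookup-index (f∈xs i)) (trans (cong (lookup xs) eq) (sym (lookup-index (f∈xs j)))))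

sum-map-incr : ∀ {g f : A → ℕ} {i is} → Unique is → i ∈ is → g i ≡ suc (f i) → (∀ {j} → ¬ i ≡ j → g j ≡ f j) →
               sum (map g is) ≡ suc (sum (map f is))
sum-map-incr (i∉ ∷ _) (here refl) gi≡ g≡f =
  cong₂ _+_ gi≡ (cong sum (map-cong-local (All.map g≡f i∉)))
sum-map-incr {g = g} {f} {i} {j ∷ is} (j∉ ∷ uniq) (there i∈) gi≡ g≡f = begin
  g j + sum (map g is)        ≡⟨ cong₂ _+_ (g≡f i≢j) (sum-map-incr uniq i∈ gi≡ g≡f) ⟩
  f j + suc (sum (map f is))  ≡⟨ +-suc (f j) _ ⟩
  suc (f j + sum (map f is))  ∎
  where open ≡-Reasoning
        i≢j : ¬ i ≡ j
        i≢j refl = All.lookup j∉ i∈ refl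

module _ {I : Set} (_≟_ : DecidableEquality I) (k : A → I) where

  sum-length-fibres : ∀ {is} → Unique is → ∀ {U} → All (λ u → k u ∈ is) U →
                      sum (map (λ i → length (filter (λ u → k u ≟ i) U)) is) ≡ length U
  sum-length-fibres {is} _ [] = sum-zeros is
    where sum-zeros : ∀ is → sum (map (λ i → length (filter (λ u → k u ≟ i) [])) is) ≡ 0
          sum-zeros []       = refl
          sum-zeros (_ ∷ is) = sum-zeros is
  sum-length-fibres uniq {u ∷ U} (ku∈ ∷ k∈) =
    trans (sum-map-incr uniq ku∈ (cong length (filter-accept (λ v → k v ≟ k u) refl))
                                 (λ ku≢i → cong length (filter-reject (λ v → k v ≟ _) ku≢i)))
          (cong suc (sum-length-fibres uniq k∈))

_⊕_ : Tm s → Tm n → Tm (s + n)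
_⊕_ {s} {n} f g = join s n ∘ Sum.map f g ∘ splitAt s

⊕-· : (f f′ : Tm s) (g g′ : Tm n) → ((f ⊕ g) · (f′ ⊕ g′)) ≗ ((f · f′) ⊕ (g · g′))
⊕-· {s} {n} f f′ g g′ x with splitAt s x
... | inj₁ y rewrite splitAt-join s n (inj₁ (f y)) = refl
... | inj₂ y rewrite splitAt-join s n (inj₂ (g y)) = refl

⊕-cong : {f f′ : Tm s} {g g′ : Tm n} → f ≗ f′ → g ≗ g′ → (f ⊕ g) ≗ (f′ ⊕ g′)
⊕-cong {s} f≗f′ g≗g′ x with splitAt s x
... | inj₁ y = cong (_↑ˡ _) (f≗f′ y)
... | inj₂ y = cong (s ↑ʳ_) (g≗g′ y)

⊕-injective : {f f′ : Tm s} {g g′ : Tm n} → (f ⊕ g) ≗ (f′ ⊕ g′) → f ≗ f′ × g ≗ g′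
⊕-injective {s} {n} {f} {f′} {g} {g′} eq = f≗f′ , g≗g′
  where
    f≗f′ : f ≗ f′
    f≗f′ y with eq (y ↑ˡ n)
    ... | e rewrite splitAt-↑ˡ s y n = ↑ˡ-injective n _ _ e
    g≗g′ : g ≗ g′
    g≗g′ y with eq (s ↑ʳ y)
    ... | e rewrite splitAt-↑ʳ s n y = ↑ʳ-injective s _ _ e

remQuot-injective : ∀ (i j : Fin (m * n)) → remQuot {m} n i ≡ remQuot n j → i ≡ j
remQuot-injective {m} {n} i j eq = begin
  i                                  ≡⟨ combine-remQuot {m} n i ⟨
  uncurry combine (remQuot {m} n i)  ≡⟨ cong (uncurry combine) eq ⟩
  uncurry combine (remQuot {m} n j)  ≡⟨ combine-remQuot {m} n j ⟩
  j                                  ∎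
  where open ≡-Reasoning

urn-⊕ : URNSubsemigroup s P₁ Q₁ → URNSubsemigroup n P₂ Q₂ → URNSubsemigroup (s + n) (P₁ * P₂) (Q₁ * Q₂)
urn-⊕ {s} {P₁} {Q₁} {n} {P₂} {Q₂} S T = record
  { elt      = elt
  ; zeroIdx  = λ b → combine (S.zeroIdx (quotient P₂ b)) (T.zeroIdx (remainder {P₁} P₂ b))
  ; elt-inj  = λ b i c j eq → let eqS , eqT = ⊕-injective eq
                                  b≡ , i≡ = S.elt-inj _ _ _ _ eqS
                                  b≡′ , i≡′ = T.elt-inj _ _ _ _ eqT
                              in remQuot-injective b c (cong₂ _,_ b≡ b≡′)
                               , remQuot-injective i j (cong₂ _,_ i≡ i≡′)
  ; elt-mult = elt-mult
  }
  where
    module S = URNSubsemigroup S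
    module T = URNSubsemigroup T
    elt : Fin (P₁ * P₂) → Fin (Q₁ * Q₂) → Tm (s + n)
    elt b i = S.elt (quotient P₂ b) (quotient Q₂ i) ⊕ T.elt (remainder {P₁} P₂ b) (remainder {Q₁} Q₂ i)
    elt-combine : ∀ b i j → elt b (combine i j) ≡ S.elt (quotient P₂ b) i ⊕ T.elt (remainder {P₁} P₂ b) j
    elt-combine b i j =
      cong (λ (i′ , j′) → S.elt (quotient P₂ b) i′ ⊕ T.elt (remainder {P₁} P₂ b) j′)
           (remQuot-combine {Q₁} {Q₂} i j)
    elt-mult : ∀ b i c j →
               (elt b i · elt c j) ≗ elt c (combine (S.zeroIdx (quotient P₂ c)) (T.zeroIdx (remainder {P₁} P₂ c)))
    elt-mult b i c j x = begin
      (elt b i · elt c j) x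
        ≡⟨ ⊕-· (S.elt b₁ i₁) (S.elt c₁ j₁) (T.elt b₂ i₂) (T.elt c₂ j₂) x ⟩
      ((S.elt b₁ i₁ · S.elt c₁ j₁) ⊕ (T.elt b₂ i₂ · T.elt c₂ j₂)) x
        ≡⟨ ⊕-cong (S.elt-mult b₁ i₁ c₁ j₁) (T.elt-mult b₂ i₂ c₂ j₂) x ⟩
      (S.elt c₁ (S.zeroIdx c₁) ⊕ T.elt c₂ (T.zeroIdx c₂)) x
        ≡⟨ cong-app (elt-combine c _ _) x ⟨
      elt c (combine (S.zeroIdx c₁) (T.zeroIdx c₂)) x ∎
      where open ≡-Reasoning
            b₁ = quotient P₂ b ; b₂ = remainder {P₁} P₂ b
            c₁ = quotient P₂ c ; c₂ = remainder {P₁} P₂ c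
            i₁ = quotient Q₂ i ; i₂ = remainder {Q₁} Q₂ i
            j₁ = quotient Q₂ j ; j₂ = remainder {Q₁} Q₂ j

urn-empty : URNSubsemigroup 0 1 1
urn-empty = record
  { elt      = λ _ _ ()
  ; zeroIdx  = λ _ → zero
  ; elt-inj  = λ { zero zero zero zero _ → refl , refl }
  ; elt-mult = λ _ _ _ _ ()
  }

funToFin-cong : {f g : Fin m → Fin n} → f ≗ g → funToFin f ≡ funToFin g
funToFin-cong {zero}  _   = refl
funToFin-cong {suc m} f≗g = cong₂ combine (f≗g zero) (funToFin-cong (f≗g ∘ suc))

finToFun-injective : ∀ {n m} (i j : Fin (n ^ m)) → finToFun {n} {m} i ≗ finToFun j → i ≡ j
finToFun-injective {n} {m} i j eq = begin
  i                              ≡⟨ funToFin-finToFin {m} {n} i ⟨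
  funToFin (finToFun {n} {m} i)  ≡⟨ funToFin-cong eq ⟩
  funToFin (finToFun {n} {m} j)  ≡⟨ funToFin-finToFin {m} {n} j ⟩
  j                              ∎
  where open ≡-Reasoning

module _ (t d : ℕ) where

  blockMap : Fin t → (Fin d → Fin t) → Tm (t + d)
  blockMap β f = (_↑ˡ d) ∘ [ const β , f ]′ ∘ splitAt t

  blockMap-· : ∀ β f γ g → (blockMap β f · blockMap γ g) ≗ blockMap γ (const γ)
  blockMap-· β f γ g x with splitAt t x
  ... | inj₁ _ rewrite splitAt-↑ˡ t β d = refl
  ... | inj₂ u rewrite splitAt-↑ˡ t (f u) d = refl

  blockMap-cong : ∀ β {f g} → f ≗ g → blockMap β f ≗ blockMap β g
  blockMap-cong β f≗g x with splitAt t x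
  ... | inj₁ _ = refl
  ... | inj₂ u = cong (_↑ˡ d) (f≗g u)

blockMap-injective : ∀ {t d β γ f g} → blockMap (suc t) d β f ≗ blockMap (suc t) d γ g → β ≡ γ × f ≗ g
blockMap-injective {t} {d} {β} {γ} {f} {g} eq = β≡γ , f≗g
  where
    β≡γ : β ≡ γ
    β≡γ with eq (zero ↑ˡ d)
    ... | e rewrite splitAt-↑ˡ (suc t) zero d = ↑ˡ-injective d β γ e
    f≗g : f ≗ g
    f≗g u with eq (suc t ↑ʳ u)
    ... | e rewrite splitAt-↑ʳ (suc t) d u = ↑ˡ-injective d (f u) (g u) e

urn-block : ∀ t d → URNSubsemigroup (suc t + d) (suc t) (suc t ^ d)
urn-block t d = record
  { elt      = λ β j → blockMap (suc t) d β (finToFun j)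
  ; zeroIdx  = λ β → funToFin {d} (const β)
  ; elt-inj  = λ β i γ j eq → let β≡γ , i≗j = blockMap-injective eq in β≡γ , finToFun-injective i j i≗j
  ; elt-mult = λ β i γ j x → trans (blockMap-· (suc t) d β (finToFun i) γ (finToFun j) x)
                                      (blockMap-cong (suc t) d γ (sym ∘ finToFun-funToFin (const γ)) x)
  }

transpose-matchˡ : ∀ {n} (i j : Fin n) → transpose i j i ≡ j
transpose-matchˡ i j rewrite dec-true (i ≟ i) refl = refl

transpose-injective : ∀ {n} (i j : Fin n) {k l} → transpose i j k ≡ transpose i j l → k ≡ l
transpose-injective i j {k} {l} eq = begin
  k                                ≡⟨ transpose-inverse j i ⟨
  transpose j i (transpose i j k)  ≡⟨ cong (transpose j i) eq ⟩
  transpose j i (transpose i j l)  ≡⟨ transpose-inverse j i ⟩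
  l                                ∎
  where open ≡-Reasoning

urn-shrink : ∀ {m P Q p q} → URNSubsemigroup m P Q → p ≤ P → suc q ≤ Q → URNSubsemigroup m p (suc q)
urn-shrink {m} {P} {Q} {p} {q} S p≤P q<Q = record
  { elt      = elt
  ; zeroIdx  = λ _ → zero
  ; elt-inj  = elt-inj
  ; elt-mult = λ b i c j x → trans (S.elt-mult _ _ _ _ x)
                                    (cong (λ k → S.elt (ι c) k x) (sym (transpose-matchˡ (inject≤ zero q<Q) _)))
  }
  where
    module S = URNSubsemigroup S
    ι : Fin p → Fin P
    ι b = inject≤ b p≤P
    -- the transposition makes index 0 the zero of every block
    κ : Fin p → Fin (suc q) → Fin Q
    κ b j = transpose (inject≤ zero q<Q) (S.zeroIdx (ι b)) (inject≤ j q<Q)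
    elt : Fin p → Fin (suc q) → Tm m
    elt b j = S.elt (ι b) (κ b j)
    elt-inj : ∀ b i c j → elt b i ≗ elt c j → b ≡ c × i ≡ j
    elt-inj b i c j eq with S.elt-inj _ _ _ _ eq
    ... | ιb≡ιc , κ≡ with refl ← inject≤-injective p≤P p≤P b c ιb≡ιc =
      refl , inject≤-injective q<Q q<Q i j (transpose-injective _ _ κ≡)

urn-fromComposition : ∀ σ τ → Positive τ → τ ⪯ σ → URNSubsemigroup (sum σ) (∏ τ) (η σ τ)
urn-fromComposition []      []          []      []            = urn-empty
urn-fromComposition (s ∷ σ) (suc t ∷ τ) (_ ∷ τ>0) (t≤s ∷ τ⪯σ) =
  urn-⊕ (subst (λ k → URNSubsemigroup k (suc t) (suc t ^ (s ∸ suc t))) (m+[n∸m]≡n t≤s)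
               (urn-block t (s ∸ suc t)))
        (urn-fromComposition σ τ τ>0 τ⪯σ)

η-map : ∀ {A : Set} (f g : A → ℕ) xs → η (map f xs) (map g xs) ≡ product (map (λ x → g x ^ (f x ∸ g x)) xs)
η-map f g []       = refl
η-map f g (x ∷ xs) = cong (g x ^ (f x ∸ g x) *_) (η-map f g xs)

module Fibres {m p q} (S : URNSubsemigroup m p q) (b₀ : Fin p) where
  open URNSubsemigroup S

  z : Fin p → Tm m
  z b = elt b (zeroIdx b)

  ρ : Tm m
  ρ = z b₀

  z-ρ : ∀ b u → z b (ρ u) ≡ z b u
  z-ρ b u = elt-mult b₀ (zeroIdx b₀) b (zeroIdx b) u

  ρ-idem : ∀ u → ρ (ρ u) ≡ ρ u
  ρ-idem = z-ρ b₀

  Inert : Fin m → Set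
  Inert v = ∀ c j → elt c j v ≡ z c v

  Inert? : ∀ v → Dec (Inert v)
  Inert? v = all? λ c → all? λ j → elt c j v ≟ z c v

  elt-inert : ∀ b i u → Inert (elt b i u)
  elt-inert b i u c j = trans (elt-mult b i c j u) (sym (elt-mult b i c (zeroIdx c) u))

  fixedPoints : List (Fin m)
  fixedPoints = filter (λ a → ρ a ≟ a) (allFin m)

  fibre : Fin m → List (Fin m)
  fibre a = filter (λ u → ρ u ≟ a) (allFin m)

  inertFibre nonInertFibre : Fin m → List (Fin m)
  inertFibre    = filter Inert? ∘ fibre
  nonInertFibre = filter (∁? Inert?) ∘ fibre

  σ τ : List ℕ
  σ = map (length ∘ fibre) fixedPoints
  τ = map (length ∘ inertFibre) fixedPoints

  ρ∈fixedPoints : ∀ u → ρ u ∈ fixedPoints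
  ρ∈fixedPoints u = ∈-filter⁺ (λ a → ρ a ≟ a) (∈-allFin (ρ u)) (ρ-idem u)

  ∈-inertFibre : ∀ {a v} → ρ v ≡ a → Inert v → v ∈ inertFibre a
  ∈-inertFibre ρv≡a inert = ∈-filter⁺ Inert? (∈-filter⁺ (λ u → ρ _ ≟ _) (∈-allFin _) ρv≡a) inert

  ρ-fixedPoint : ∀ {a} → a ∈ fixedPoints → ρ a ≡ a
  ρ-fixedPoint = All.lookup (all-filter (λ a → ρ a ≟ a) (allFin m))

  fixed∈inertFibre : ∀ {a} → a ∈ fixedPoints → a ∈ inertFibre a
  fixed∈inertFibre {a} a∈ =
    ∈-inertFibre (ρ-fixedPoint a∈) (subst Inert (ρ-fixedPoint a∈) (elt-inert b₀ (zeroIdx b₀) a))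

  ρ-nonInertFibre : ∀ a → All (λ u → ρ u ≡ a) (nonInertFibre a)
  ρ-nonInertFibre a = All.filter⁺ (∁? Inert?) (all-filter (λ u → ρ u ≟ a) (allFin m))

  length-nonInertFibre : ∀ a → length (nonInertFibre a) ≡ length (fibre a) ∸ length (inertFibre a)
  length-nonInertFibre a = begin
    length (nonInertFibre a)
      ≡⟨ m+n∸m≡n (length (inertFibre a)) _ ⟨
    length (inertFibre a) + length (nonInertFibre a) ∸ length (inertFibre a)
      ≡⟨ cong (_∸ length (inertFibre a)) (length-filter-∁ Inert? (fibre a)) ⟩
    length (fibre a) ∸ length (inertFibre a) ∎
    where open ≡-Reasoning

  σ-composition : IsCompositionOf m σ
  σ-composition =
      All.map⁺ (All.tabulate λ a∈ → ≤-trans (∈-length (fixed∈inertFibre a∈)) (length-filter Inert? (fibre _)))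
    , trans (sum-length-fibres _≟_ ρ (Unique.filter⁺ _ (Unique.allFin⁺ m))
                                     (All.universal ρ∈fixedPoints (allFin m)))
            (length-tabulate (λ u → u))

  τ-positive : Positive τ
  τ-positive = All.map⁺ (All.tabulate λ a∈ → ∈-length (fixed∈inertFibre a∈))

  τ⪯σ : τ ⪯ σ
  τ⪯σ = pointwise-map (All.universal (λ a → length-filter Inert? (fibre a)) fixedPoints)

  z∈choices : ∀ b → map (z b) fixedPoints ∈ choices inertFibre fixedPoints
  z∈choices b = map-∈-choices (All.tabulate λ {a} a∈ →
    ∈-inertFibre (trans (elt-mult b (zeroIdx b) b₀ (zeroIdx b₀) a) (ρ-fixedPoint a∈)) (elt-inert b (zeroIdx b) a))

  z-injective : ∀ {b c} → map (z b) fixedPoints ≡ map (z c) fixedPoints → b ≡ c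
  z-injective {b} {c} eq = proj₁ (elt-inj b (zeroIdx b) c (zeroIdx c) λ u → begin
    z b u      ≡⟨ z-ρ b u ⟨
    z b (ρ u)  ≡⟨ All.lookup (map-≡⇒All fixedPoints eq) (ρ∈fixedPoints u) ⟩
    z c (ρ u)  ≡⟨ z-ρ c u ⟩
    z c u      ∎)
    where open ≡-Reasoning

  ∏τ≥p : ∏ τ ≥ p
  ∏τ≥p = subst (p ≤_) (length-choices inertFibre fixedPoints)
           (injective⇒≤length (choices inertFibre fixedPoints) z∈choices z-injective)

  nonInert : List (Fin m)
  nonInert = concatMap nonInertFibre fixedPoints

  ∈-nonInert : ∀ {u} → ¬ Inert u → u ∈ nonInert
  ∈-nonInert {u} ¬inert = ∈-concatMap⁺ nonInertFibre
    (lose (ρ∈fixedPoints u) (∈-filter⁺ (∁? Inert?) (∈-filter⁺ (λ v → ρ v ≟ ρ u) (∈-allFin u) refl) ¬inert))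

  elt∈choices : ∀ j → map (elt b₀ j) nonInert ∈ choices (inertFibre ∘ ρ) nonInert
  elt∈choices j = map-∈-choices (All.universal
    (λ u → ∈-inertFibre (elt-mult b₀ j b₀ (zeroIdx b₀) u) (elt-inert b₀ j u)) nonInert)

  elt-injective : ∀ {j k} → map (elt b₀ j) nonInert ≡ map (elt b₀ k) nonInert → j ≡ k
  elt-injective {j} {k} eq = proj₂ (elt-inj b₀ j b₀ k agree)
    where
      agree : elt b₀ j ≗ elt b₀ k
      agree u with Inert? u
      ... | yes inert = trans (inert b₀ j) (sym (inert b₀ k))
      ... | no ¬inert = All.lookup (map-≡⇒All nonInert eq) (∈-nonInert ¬inert)

  length-choices-nonInert : length (choices (inertFibre ∘ ρ) nonInert) ≡ η σ τ
  length-choices-nonInert = begin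
    length (choices (inertFibre ∘ ρ) nonInert)
      ≡⟨ length-choices (inertFibre ∘ ρ) nonInert ⟩
    product (map (length ∘ inertFibre ∘ ρ) nonInert)
      ≡⟨ product-map-concatMap (length ∘ inertFibre ∘ ρ) nonInertFibre fixedPoints ⟩
    product (map (λ a → product (map (length ∘ inertFibre ∘ ρ) (nonInertFibre a))) fixedPoints)
      ≡⟨ cong product (map-cong (λ a → product-map-const (All.map (cong (length ∘ inertFibre)) (ρ-nonInertFibre a)))
                                fixedPoints) ⟩
    product (map (λ a → length (inertFibre a) ^ length (nonInertFibre a)) fixedPoints)
      ≡⟨ cong product (map-cong (λ a → cong (length (inertFibre a) ^_) (length-nonInertFibre a)) fixedPoints) ⟩
    product (map (λ a → length (inertFibre a) ^ (length (fibre a) ∸ length (inertFibre a))) fixedPoints)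
      ≡⟨ η-map (length ∘ fibre) (length ∘ inertFibre) fixedPoints ⟨
    η σ τ ∎
    where open ≡-Reasoning

  η≥q : η σ τ ≥ q
  η≥q = subst (q ≤_) length-choices-nonInert
          (injective⇒≤length (choices (inertFibre ∘ ρ) nonInert) elt∈choices elt-injective)

AdmissiblePair : ℕ → ℕ → ℕ → Set
AdmissiblePair m p q = ∃₂ λ (σ τ : List ℕ) → IsCompositionOf m σ × Positive τ × τ ⪯ σ × ∏ τ ≥ p × η σ τ ≥ q

urn⇒admissible : URNSubsemigroup m p q → Fin p → AdmissiblePair m p q
urn⇒admissible S b₀ = σ , τ , σ-composition , τ-positive , τ⪯σ , ∏τ≥p , η≥q
  where open Fibres S b₀

admissible⇒urn : AdmissiblePair m p (suc q) → URNSubsemigroup m p (suc q)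
admissible⇒urn (σ , τ , (_ , sum≡m) , τ>0 , τ⪯σ , ∏τ≥p , η≥q) =
  urn-shrink (subst (λ k → URNSubsemigroup k (∏ τ) (η σ τ)) sum≡m (urn-fromComposition σ τ τ>0 τ⪯σ))
             ∏τ≥p η≥q

lemma4p25 : (m p q : ℕ) → 1 ≤ p → 1 ≤ q →
    (URNSubsemigroup m p q ⇔
    ∃₂ λ (σ τ : List ℕ) → IsCompositionOf m σ × Positive τ × τ ⪯ σ × ∏ τ ≥ p × η σ τ ≥ q)
lemma4p25 m (suc p) (suc q) _ _ = mk⇔ (λ S → urn⇒admissible S zero) admissible⇒urn
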